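{- For every permutation $\tau$ of $[n]$, \[ \mathcal F_\tau=P_{\{\tau^{ -1}(1)\}|\{\tau^{ -1}(2)\}|\cdots|\{\tau^{ -1}(n)\}}. \]
   Context: Notation: $x_1,x_2,\dots$ are non-commuting variables, and $x_w=x_{w_1}\cdots x_{w_n}$ for a word $w$ of positive integers. Standardization: the standardization $\mathrm{std}(w)$ of a word $w$ of length $n$ is the permutation of $[n]$ obtained by replacing the letters of $w$ by $1,\dots,n$ in increasing order of value, with equal letters numbered from left to right. The fundamental basis of $\mathrm{FQSym}$, realized in non-commuting variables, is $\mathcal F_\tau=\sum_{w:\ \mathrm{std}(w)=\tau}x_w$. Set compositions: a set composition $\Phi=B_1|\cdots|B_k$ of $n$ is a sequence of disjoint nonempty sets with union $[n]$. For a word $w$ with distinct values $v_1<\dots<v_k$, $\varrho(w)=B_1|\cdots|B_k$ with $B_r=\{i:w_i=v_r\}$, and $M_\Phi=\sum_{\varrho(w)=\Phi}x_w$. Order on blocks: $A>_{\mathcal D}B$ if $|A|>|B|$, or $|A|=|B|$ and $\min A<\min B$. LDD fillings: $\mathsf{LDD}(\Phi)$ is the set of placements of $B_i$ in row $i$ of a matrix such that the following hold. - $B_1$ is in column 1. - $B_{i+1}$ is in the same column as $B_i$ or the next column if $B_i>_{\mathcal D}B_{i+1}$, and in the next column otherwise. $\mathsf{col}(\tilde{\mathsf F})$ lists, left to right, the unions of the blocks in the nonempty columns. Then $P_\Phi=\sum_{\tilde{\mathsf F}\in\mathsf{LDD}(\Phi)}M_{\mathsf{col}(\tilde{\mathsf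 F})}$. -}

module Defs where

open import Data.Nat using (ℕ; zero; suc; _+_; _<ᵇ_; _≡ᵇ_; _⊔_; _⊓_; _≟_)
open import Data.Bool using (Bool; true; false; _∧_; _∨_; if_then_else_; not)
open import Data.List using (List; []; _∷_; length; map; concat; foldr; upTo; applyUpTo; allFin; zip; _++_)
open import Data.Nat.ListAction using (sum)
open import Data.List.Properties using (≡-dec)
open import Data.Product using (_×_; _,_; proj₁; proj₂)
open import Data.Fin using (Fin; toℕ)
open import Data.Fin.Permutation using (Permutation′; _⟨$⟩ʳ_; _⟨$⟩ˡ_)
open import Relation.Nullary.Decidable using (⌊_⌋)

-- Words are lists of letters; the letter a : ℕ stands for the variable x_{a+1}
-- (an order-preserving relabelling of the positive integers).
-- A noncommutative series is represented by its coefficient function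
-- (List ℕ → ℕ) : the coefficient of the monomial x_w.

Word : Set
Word = List ℕ

-- Set compositions: lists of blocks, each block a strictly increasing list of
-- positions (positions are 1-based, as in the paper).
SetComp : Set
SetComp = List (List ℕ)

bfilter : {A : Set} → (A → Bool) → List A → List A
bfilter p [] = []
bfilter p (x ∷ xs) = if p x then x ∷ bfilter p xs else bfilter p xs

bcount : {A : Set} → (A → Bool) → List A → ℕ
bcount p xs = length (bfilter p xs)

anyB : {A : Set} → (A → Bool) → List A → Bool
anyB p = foldr (λ x b → p x ∨ b) false

maxL : List ℕ → ℕ
maxL = foldr _⊔_ 0

minL : List ℕ → ℕ
minL [] = 0
minL (x ∷ xs) = foldr _⊓_ x xs

positions : ℕ → List ℕ
positions n = applyUpTo suc n

-- Standardization: std(w)_i = #{j : w_j < w_i} + #{j < i : w_j = w_i} + 1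

std : Word → List ℕ
std w = map rk iw
  where
  iw : List (ℕ × ℕ)
  iw = zip (upTo (length w)) w
  rk : ℕ × ℕ → ℕ
  rk (i , a) = suc (bcount (λ b → b <ᵇ a) w
                    + bcount (λ jb → (proj₁ jb <ᵇ i) ∧ (proj₂ jb ≡ᵇ a)) iw)

-- one-line notation [τ(1), ..., τ(n)] of a permutation (values 1-based)
oneLine : {n : ℕ} → Permutation′ n → List ℕ
oneLine {n} τ = map (λ i → suc (toℕ (τ ⟨$⟩ʳ i))) (allFin n)

-- coefficient function of F_τ = Σ_{std(w)=τ} x_w
Fτ : {n : ℕ} → Permutation′ n → Word → ℕ
Fτ τ w = if ⌊ ≡-dec _≟_ (std w) (oneLine τ) ⌋ then 1 else 0

-- ϱ(w) = B_1 | ... | B_k,  B_r = {i : w_i = v_r}, v_1 < ... < v_k the values of w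

ϱ : Word → SetComp
ϱ w = map block values
  where
  values : List ℕ
  values = bfilter (λ v → anyB (λ a → v ≡ᵇ a) w) (upTo (suc (maxL w)))
  block : ℕ → List ℕ
  block v = map proj₁ (bfilter (λ ia → proj₂ ia ≡ᵇ v) (zip (positions (length w)) w))

-- coefficient function of M_Φ = Σ_{ϱ(w)=Φ} x_w
M : SetComp → Word → ℕ
M Φ w = if ⌊ ≡-dec (≡-dec _≟_) (ϱ w) Φ ⌋ then 1 else 0

_>D_ : List ℕ → List ℕ → Bool
A >D B = (length B <ᵇ length A) ∨ ((length A ≡ᵇ length B) ∧ (minL A <ᵇ minL B))

colSeqsFrom : ℕ → ℕ → List (List ℕ)
colSeqsFrom zero c = [] ∷ []
colSeqsFrom (suc k) c = map (c ∷_) (colSeqsFrom k c) ++ map (suc c ∷_) (colSeqsFrom k (suc c))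

colSeqs : ℕ → List (List ℕ)
colSeqs zero = [] ∷ []
colSeqs (suc k) = map (1 ∷_) (colSeqsFrom k 1)

validPairs : List (List ℕ × ℕ) → Bool
validPairs [] = true
validPairs (_ ∷ []) = true
validPairs ((B , c) ∷ (B' , c') ∷ rest) =
  (not (c ≡ᵇ c') ∨ (B >D B')) ∧ validPairs ((B' , c') ∷ rest)

valid : SetComp → List ℕ → Bool
valid Φ cs = validPairs (zip Φ cs)

-- LDD(Φ): a filling is given by the column c_i of each row i (block B_i in row i)
LDD : SetComp → List (List ℕ)
LDD Φ = bfilter (valid Φ) (colSeqs (length Φ))

unionB : ℕ → List (List ℕ) → List ℕ
unionB N bs = bfilter (λ p → anyB (λ q → p ≡ᵇ q) (concat bs)) (positions N)

nonempty : List ℕ → Bool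
nonempty [] = false
nonempty (_ ∷ _) = true

col : SetComp → List ℕ → SetComp
col Φ cs = bfilter nonempty (map column (positions (maxL cs)))
  where
  N : ℕ
  N = maxL (concat Φ)
  column : ℕ → List ℕ
  column j = unionB N (map proj₁ (bfilter (λ Bc → proj₂ Bc ≡ᵇ j) (zip Φ cs)))

-- coefficient function of P_Φ = Σ_{F ∈ LDD(Φ)} M_{col(F)}
P : SetComp → Word → ℕ
P Φ w = sum (map (λ F → M (col Φ F) w) (LDD Φ))

singletonsInv : {n : ℕ} → Permutation′ n → SetComp
singletonsInv {n} τ = map (λ j → suc (toℕ (τ ⟨$⟩ˡ j)) ∷ []) (allFin n)

module Submission where

-- For singleton blocks the LDD rule lets rows i and i+1 share a column only when
-- τ⁻¹(i) < τ⁻¹(i+1), and a filling is a sequence of columns c with c₁ = 1 and unit steps.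
-- col(F) puts position τ⁻¹(i) into column cᵢ, so ϱ(w) = col(F) says that c_{τ(j)} is the
-- rank of w_j among the distinct letters of w. Hence at most one filling contributes to the
-- coefficient of x_w in P, the one read off from the packed word of w; it is a column
-- sequence obeying the LDD rule exactly when τ increases along the standardization order of
-- w, i.e. when std(w) = τ. So both sides have coefficient [std(w) = τ].

open import Defs
open import Data.Bool using (Bool; true; false; _∧_; _∨_; not; if_then_else_)
open import Data.Bool.Properties using (T-≡; ∨-identityʳ; ∧-identityʳ; ∨-zeroʳ; ∧-zeroʳ; ∧-conicalˡ; ∧-conicalʳ)
open import Data.Empty using (⊥-elim)
open import Data.Fin using (Fin; toℕ; fromℕ<)
open import Data.Fin.Permutation using (Permutation′; _⟨$⟩ʳ_; _⟨$⟩ˡ_; inverseˡ; inverseʳ)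
open import Data.Fin.Properties using (toℕ<n; fromℕ<-toℕ; toℕ-fromℕ<)
open import Data.List using (List; []; _∷_; length; map; concat; applyUpTo; upTo; zip; tabulate; _++_)
open import Data.List.Membership.Propositional using (_∈_)
open import Data.List.Membership.Propositional.Properties using (∈-applyUpTo⁺; ∈-applyUpTo⁻; ∈-map⁻; ∈-++⁻)
open import Data.List.Properties using (≡-dec; map-injective; map-++; map-∘; map-cong; length-applyUpTo; map-applyUpTo; map-tabulate; tabulate-cong)
open import Data.List.Relation.Unary.Any using (here; there)
open import Data.Nat using (ℕ; zero; suc; pred; ≢-nonZero; >-nonZero; _+_; _∸_; _⊔_; _≤_; _<_; z≤n; s≤s; _<ᵇ_; _≡ᵇ_)
open import Data.Nat.ListAction using (sum)
open import Data.Nat.ListAction.Properties using (sum-++)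
open import Data.Nat.Properties
open import Algebra.Properties.CommutativeSemigroup +-commutativeSemigroup
  using () renaming (interchange to +-interchange)
open import Data.Product using (_×_; _,_; proj₁; proj₂; ∃-syntax)
open import Data.Sum using (_⊎_; inj₁; inj₂)
open import Data.Unit using (⊤; tt)
open import Function using (_∘_; id)
open import Function.Bundles using (module Equivalence)
open import Relation.Binary.Definitions using (tri<; tri≈; tri>)
open import Relation.Binary.PropositionalEquality
open import Relation.Nullary using (¬_; yes; no; contradiction)

𝟙 : Bool → ℕ
𝟙 b = if b then 1 else 0

≡ᵇ-true⇒≡ : ∀ m n → (m ≡ᵇ n) ≡ true → m ≡ n
≡ᵇ-true⇒≡ m n e = ≡ᵇ⇒≡ m n (Equivalence.from T-≡ e)

≡⇒≡ᵇ-true : ∀ m n → m ≡ n → (m ≡ᵇ n) ≡ true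
≡⇒≡ᵇ-true m n e = Equivalence.to T-≡ (≡⇒≡ᵇ m n e)

≢⇒≡ᵇ-false : ∀ m n → m ≢ n → (m ≡ᵇ n) ≡ false
≢⇒≡ᵇ-false m n m≢n with m ≡ᵇ n in e
... | true  = ⊥-elim (m≢n (≡ᵇ-true⇒≡ m n e))
... | false = refl

<ᵇ-true⇒< : ∀ m n → (m <ᵇ n) ≡ true → m < n
<ᵇ-true⇒< m n e = <ᵇ⇒< m n (Equivalence.from T-≡ e)

<⇒<ᵇ-true : ∀ m n → m < n → (m <ᵇ n) ≡ true
<⇒<ᵇ-true m n m<n = Equivalence.to T-≡ (<⇒<ᵇ m<n)

≮⇒<ᵇ-false : ∀ m n → ¬ (m < n) → (m <ᵇ n) ≡ false
≮⇒<ᵇ-false m n m≮n with m <ᵇ n in e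
... | true  = ⊥-elim (m≮n (<ᵇ-true⇒< m n e))
... | false = refl

≡ᵇ-sym : ∀ a b → (a ≡ᵇ b) ≡ (b ≡ᵇ a)
≡ᵇ-sym zero    zero    = refl
≡ᵇ-sym zero    (suc b) = refl
≡ᵇ-sym (suc a) zero    = refl
≡ᵇ-sym (suc a) (suc b) = ≡ᵇ-sym a b

𝟙-<ᵇ-suc : ∀ x t → 𝟙 (x <ᵇ suc t) ≡ 𝟙 (x <ᵇ t) + 𝟙 (x ≡ᵇ t)
𝟙-<ᵇ-suc zero    zero    = refl
𝟙-<ᵇ-suc zero    (suc t) = refl
𝟙-<ᵇ-suc (suc x) zero    = refl
𝟙-<ᵇ-suc (suc x) (suc t) = 𝟙-<ᵇ-suc x t

𝟙-mono : ∀ b c → (b ≡ true → c ≡ true) → 𝟙 b ≤ 𝟙 c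
𝟙-mono false c h = z≤n
𝟙-mono true  c h rewrite h refl = ≤-refl

𝟙-false<𝟙-true : ∀ b c → b ≡ false → c ≡ true → 𝟙 b < 𝟙 c
𝟙-false<𝟙-true b c refl refl = s≤s z≤n

nth : {A : Set} → A → List A → ℕ → A
nth d []       i       = d
nth d (x ∷ xs) zero    = x
nth d (x ∷ xs) (suc i) = nth d xs i

nth-applyUpTo : ∀ {A : Set} (d : A) m (f : ℕ → A) i → i < m → nth d (applyUpTo f m) i ≡ f i
nth-applyUpTo d (suc m) f zero    _         = refl
nth-applyUpTo d (suc m) f (suc i) (s≤s i<m) = nth-applyUpTo d m (f ∘ suc) i i<m

nth-∈ : ∀ {A : Set} (d : A) xs i → i < length xs → nth d xs i ∈ xs
nth-∈ d (x ∷ xs) zero    _         = here refl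
nth-∈ d (x ∷ xs) (suc i) (s≤s i<n) = there (nth-∈ d xs i i<n)

∈⇒nth : ∀ {A : Set} (d : A) xs x → x ∈ xs → ∃[ i ] (i < length xs × nth d xs i ≡ x)
∈⇒nth d (y ∷ xs) x (here refl) = 0 , s≤s z≤n , refl
∈⇒nth d (y ∷ xs) x (there x∈xs) with ∈⇒nth d xs x x∈xs
... | i , i<n , e = suc i , s≤s i<n , e

nth-extensionality : ∀ {A : Set} (d : A) (xs ys : List A) → length xs ≡ length ys →
                     (∀ i → i < length xs → nth d xs i ≡ nth d ys i) → xs ≡ ys
nth-extensionality d []       []       _ _ = refl
nth-extensionality d (x ∷ xs) (y ∷ ys) e h =
  cong₂ _∷_ (h 0 (s≤s z≤n)) (nth-extensionality d xs ys (suc-injective e) (λ i p → h (suc i) (s≤s p)))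

applyUpTo-cong : ∀ {A : Set} m (f g : ℕ → A) → (∀ i → i < m → f i ≡ g i) → applyUpTo f m ≡ applyUpTo g m
applyUpTo-cong zero    f g h = refl
applyUpTo-cong (suc m) f g h =
  cong₂ _∷_ (h 0 (s≤s z≤n)) (applyUpTo-cong m (f ∘ suc) (g ∘ suc) (λ i p → h (suc i) (s≤s p)))

applyUpTo-injective : ∀ {A : Set} (d : A) m k (f g : ℕ → A) → applyUpTo f m ≡ applyUpTo g k →
                      m ≡ k × (∀ i → i < m → f i ≡ g i)
applyUpTo-injective d m k f g e = m≡k , λ i i<m →
  trans (sym (nth-applyUpTo d m f i i<m))
        (trans (cong (λ l → nth d l i) e) (nth-applyUpTo d k g i (subst (i <_) m≡k i<m)))
  where
  m≡k : m ≡ k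
  m≡k = trans (sym (length-applyUpTo f m)) (trans (cong length e) (length-applyUpTo g k))

tabulate-toℕ : ∀ {A : Set} n (g : ℕ → A) → tabulate {n = n} (g ∘ toℕ) ≡ applyUpTo g n
tabulate-toℕ zero    g = refl
tabulate-toℕ (suc n) g = cong (g 0 ∷_) (tabulate-toℕ n (g ∘ suc))

∈-bfilter-applyUpTo⁻ : ∀ {A : Set} m (f : ℕ → A) (p : A → Bool) x → x ∈ bfilter p (applyUpTo f m) →
                       ∃[ i ] (i < m × f i ≡ x × p x ≡ true)
∈-bfilter-applyUpTo⁻ (suc m) f p x x∈ with p (f 0) in p0
∈-bfilter-applyUpTo⁻ (suc m) f p x (here refl) | true = 0 , s≤s z≤n , refl , p0
∈-bfilter-applyUpTo⁻ (suc m) f p x (there x∈) | true with ∈-bfilter-applyUpTo⁻ m (f ∘ suc) p x x∈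
... | i , i<m , fi≡x , px = suc i , s≤s i<m , fi≡x , px
∈-bfilter-applyUpTo⁻ (suc m) f p x x∈ | false with ∈-bfilter-applyUpTo⁻ m (f ∘ suc) p x x∈
... | i , i<m , fi≡x , px = suc i , s≤s i<m , fi≡x , px

∈-bfilter-applyUpTo⁺ : ∀ {A : Set} m (f : ℕ → A) (p : A → Bool) i → i < m → p (f i) ≡ true →
                       f i ∈ bfilter p (applyUpTo f m)
∈-bfilter-applyUpTo⁺ (suc m) f p zero    _         pfi rewrite pfi = here refl
∈-bfilter-applyUpTo⁺ (suc m) f p (suc i) (s≤s i<m) pfi with p (f 0)
... | true  = there (∈-bfilter-applyUpTo⁺ m (f ∘ suc) p i i<m pfi)
... | false = ∈-bfilter-applyUpTo⁺ m (f ∘ suc) p i i<m pfi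

bfilter-cong-applyUpTo : ∀ {A : Set} m (f : ℕ → A) (p q : A → Bool) → (∀ i → i < m → p (f i) ≡ q (f i)) →
                         bfilter p (applyUpTo f m) ≡ bfilter q (applyUpTo f m)
bfilter-cong-applyUpTo zero    f p q h = refl
bfilter-cong-applyUpTo (suc m) f p q h with p (f 0) | q (f 0) | h 0 (s≤s z≤n)
... | true  | true  | _ = cong (f 0 ∷_) (bfilter-cong-applyUpTo m (f ∘ suc) p q (λ i r → h (suc i) (s≤s r)))
... | false | false | _ = bfilter-cong-applyUpTo m (f ∘ suc) p q (λ i r → h (suc i) (s≤s r))

nonempty⇒∈ : (xs : List ℕ) → nonempty xs ≡ true → ∃[ x ] (x ∈ xs)
nonempty⇒∈ (x ∷ xs) _ = x , here refl

∈⇒nonempty : (xs : List ℕ) (x : ℕ) → x ∈ xs → nonempty xs ≡ true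
∈⇒nonempty (y ∷ xs) x _ = refl

bfilter-map : ∀ {A B : Set} (p : B → Bool) (f : A → B) xs → bfilter p (map f xs) ≡ map f (bfilter (p ∘ f) xs)
bfilter-map p f []       = refl
bfilter-map p f (x ∷ xs) with p (f x)
... | true  = cong (f x ∷_) (bfilter-map p f xs)
... | false = bfilter-map p f xs

bfilter-positions : ∀ (q : ℕ → Bool) L → bfilter q (positions L) ≡ map suc (bfilter (q ∘ suc) (upTo L))
bfilter-positions q L = trans (cong (bfilter q) (sym (map-applyUpTo id suc L))) (bfilter-map q suc (upTo L))

nonempty-map : ∀ (f : ℕ → ℕ) xs → nonempty (map f xs) ≡ nonempty xs
nonempty-map f []       = refl
nonempty-map f (x ∷ xs) = refl

map-bfilter-nonempty : ∀ {A : Set} (p : A → Bool) (g : A → List ℕ) xs → (∀ x → p x ≡ nonempty (g x)) →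
                       map g (bfilter p xs) ≡ bfilter nonempty (map g xs)
map-bfilter-nonempty p g []       h = refl
map-bfilter-nonempty p g (x ∷ xs) h rewrite h x with nonempty (g x)
... | true  = cong (g x ∷_) (map-bfilter-nonempty p g xs h)
... | false = map-bfilter-nonempty p g xs h

bfilter-nonempty-map : ∀ (f : ℕ → ℕ) (xss : List (List ℕ)) →
                       bfilter nonempty (map (map f) xss) ≡ map (map f) (bfilter nonempty xss)
bfilter-nonempty-map f []              = refl
bfilter-nonempty-map f ([] ∷ xss)      = bfilter-nonempty-map f xss
bfilter-nonempty-map f ((y ∷ ys) ∷ xss) = cong (map f (y ∷ ys) ∷_) (bfilter-nonempty-map f xss)

bfilter-all : ∀ {A : Set} (p : A → Bool) (xs : List A) → (∀ x → x ∈ xs → p x ≡ true) → bfilter p xs ≡ xs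
bfilter-all p []       h = refl
bfilter-all p (x ∷ xs) h rewrite h x (here refl) = cong (x ∷_) (bfilter-all p xs (λ y y∈ → h y (there y∈)))

∈-bfilter⁻ : ∀ {A : Set} (p : A → Bool) (xs : List A) x → x ∈ bfilter p xs → x ∈ xs × p x ≡ true
∈-bfilter⁻ p (y ∷ xs) x x∈ with p y in py
∈-bfilter⁻ p (y ∷ xs) x (here refl) | true = here refl , py
∈-bfilter⁻ p (y ∷ xs) x (there x∈) | true  = let x∈xs , px = ∈-bfilter⁻ p xs x x∈ in there x∈xs , px
∈-bfilter⁻ p (y ∷ xs) x x∈          | false = let x∈xs , px = ∈-bfilter⁻ p xs x x∈ in there x∈xs , px

maxL-≤ : ∀ xs K → (∀ x → x ∈ xs → x ≤ K) → maxL xs ≤ K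
maxL-≤ []       K h = z≤n
maxL-≤ (x ∷ xs) K h = ⊔-lub (h x (here refl)) (maxL-≤ xs K (λ y y∈ → h y (there y∈)))

≤-maxL : ∀ xs x → x ∈ xs → x ≤ maxL xs
≤-maxL (y ∷ xs) x (here refl) = m≤m⊔n y (maxL xs)
≤-maxL (y ∷ xs) x (there x∈)  = ≤-trans (≤-maxL xs x x∈) (m≤n⊔m y (maxL xs))

maxL-∈ : ∀ xs → maxL xs ∈ xs ⊎ maxL xs ≡ 0
maxL-∈ []       = inj₂ refl
maxL-∈ (x ∷ xs) with ⊔-sel x (maxL xs) | maxL-∈ xs
... | inj₁ e | _       = inj₁ (here e)
... | inj₂ e | inj₁ m∈ = inj₁ (there (subst (_∈ xs) (sym e) m∈))
... | inj₂ e | inj₂ m≡0 = inj₁ (here (trans (cong (x ⊔_) m≡0) (⊔-identityʳ x)))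

maxL-≡ : ∀ xs K → (∀ x → x ∈ xs → x ≤ K) → K ∈ xs ⊎ K ≡ 0 → maxL xs ≡ K
maxL-≡ xs K h (inj₁ K∈)   = ≤-antisym (maxL-≤ xs K h) (≤-maxL xs K K∈)
maxL-≡ xs K h (inj₂ refl) = n≤0⇒n≡0 (maxL-≤ xs 0 h)

concat-singletons : ∀ m (f : ℕ → ℕ) → concat (applyUpTo (λ i → f i ∷ []) m) ≡ applyUpTo f m
concat-singletons zero    f = refl
concat-singletons (suc m) f = cong (f 0 ∷_) (concat-singletons m (f ∘ suc))

anyBelow : ℕ → (ℕ → Bool) → Bool
anyBelow zero    q = false
anyBelow (suc m) q = q 0 ∨ anyBelow m (q ∘ suc)

anyBelow-false : ∀ m q → (∀ i → i < m → q i ≡ false) → anyBelow m q ≡ false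
anyBelow-false zero    q h = refl
anyBelow-false (suc m) q h rewrite h 0 (s≤s z≤n) = anyBelow-false m (q ∘ suc) (λ i p → h (suc i) (s≤s p))

anyBelow-unique : ∀ m q i₀ → i₀ < m → (∀ i → i < m → i ≢ i₀ → q i ≡ false) → anyBelow m q ≡ q i₀
anyBelow-unique (suc m) q zero _ h =
  trans (cong (q 0 ∨_) (anyBelow-false m (q ∘ suc) (λ i r → h (suc i) (s≤s r) (λ ())))) (∨-identityʳ (q 0))
anyBelow-unique (suc m) q (suc i₀) (s≤s i₀<m) h rewrite h 0 (s≤s z≤n) (λ ()) =
  anyBelow-unique m (q ∘ suc) i₀ i₀<m (λ i r i≢ → h (suc i) (s≤s r) (i≢ ∘ suc-injective))

m∸n≡suc[m∸[1+n]] : ∀ x y → y < x → x ∸ y ≡ suc (x ∸ suc y)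
m∸n≡suc[m∸[1+n]] (suc x) zero    _         = refl
m∸n≡suc[m∸[1+n]] (suc x) (suc y) (s≤s y<x) = m∸n≡suc[m∸[1+n]] x y y<x

sumBelow : ℕ → (ℕ → ℕ) → ℕ
sumBelow zero    f = 0
sumBelow (suc m) f = f 0 + sumBelow m (f ∘ suc)

sumBelow-cong : ∀ m f g → (∀ j → j < m → f j ≡ g j) → sumBelow m f ≡ sumBelow m g
sumBelow-cong zero    f g h = refl
sumBelow-cong (suc m) f g h =
  cong₂ _+_ (h 0 (s≤s z≤n)) (sumBelow-cong m (f ∘ suc) (g ∘ suc) (λ j p → h (suc j) (s≤s p)))

sumBelow-+ : ∀ m f g → sumBelow m f + sumBelow m g ≡ sumBelow m (λ j → f j + g j)
sumBelow-+ zero    f g = refl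
sumBelow-+ (suc m) f g =
  trans (+-interchange (f 0) (sumBelow m (f ∘ suc)) (g 0) (sumBelow m (g ∘ suc)))
        (cong ((f 0 + g 0) +_) (sumBelow-+ m (f ∘ suc) (g ∘ suc)))

sumBelow-mono-≤ : ∀ m f g → (∀ j → j < m → f j ≤ g j) → sumBelow m f ≤ sumBelow m g
sumBelow-mono-≤ zero    f g h = z≤n
sumBelow-mono-≤ (suc m) f g h =
  +-mono-≤ (h 0 (s≤s z≤n)) (sumBelow-mono-≤ m (f ∘ suc) (g ∘ suc) (λ j p → h (suc j) (s≤s p)))

sumBelow-mono-< : ∀ m f g → (∀ j → j < m → f j ≤ g j) → ∀ a → a < m → f a < g a → sumBelow m f < sumBelow m g
sumBelow-mono-< (suc m) f g h zero    _         fa<ga =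
  +-mono-<-≤ fa<ga (sumBelow-mono-≤ m (f ∘ suc) (g ∘ suc) (λ j p → h (suc j) (s≤s p)))
sumBelow-mono-< (suc m) f g h (suc a) (s≤s a<m) fa<ga =
  +-mono-≤-< (h 0 (s≤s z≤n)) (sumBelow-mono-< m (f ∘ suc) (g ∘ suc) (λ j p → h (suc j) (s≤s p)) a a<m fa<ga)

sumBelow-zero : ∀ m f → (∀ j → f j ≡ 0) → sumBelow m f ≡ 0
sumBelow-zero zero    f h = refl
sumBelow-zero (suc m) f h rewrite h 0 = sumBelow-zero m (f ∘ suc) (h ∘ suc)

sumBelow-δ : ∀ m k → k < m → sumBelow m (λ j → 𝟙 (j ≡ᵇ k)) ≡ 1
sumBelow-δ (suc m) zero    _         = cong suc (sumBelow-zero m _ (λ j → refl))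
sumBelow-δ (suc m) (suc k) (s≤s k<m) = sumBelow-δ m k k<m

-- τ and τ⁻¹ acting on 0-based positions; both are 0 outside [0, n).
module OnPositions {n : ℕ} (τ : Permutation′ n) where

  perm : ℕ → ℕ
  perm i with i <? n
  ... | yes i<n = toℕ (τ ⟨$⟩ʳ fromℕ< i<n)
  ... | no  _   = 0

  perm⁻¹ : ℕ → ℕ
  perm⁻¹ i with i <? n
  ... | yes i<n = toℕ (τ ⟨$⟩ˡ fromℕ< i<n)
  ... | no  _   = 0

  perm-toℕ : ∀ (k : Fin n) → perm (toℕ k) ≡ toℕ (τ ⟨$⟩ʳ k)
  perm-toℕ k with toℕ k <? n
  ... | yes k<n = cong (λ z → toℕ (τ ⟨$⟩ʳ z)) (fromℕ<-toℕ k k<n)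
  ... | no  k≮n = ⊥-elim (k≮n (toℕ<n k))

  perm⁻¹-toℕ : ∀ (k : Fin n) → perm⁻¹ (toℕ k) ≡ toℕ (τ ⟨$⟩ˡ k)
  perm⁻¹-toℕ k with toℕ k <? n
  ... | yes k<n = cong (λ z → toℕ (τ ⟨$⟩ˡ z)) (fromℕ<-toℕ k k<n)
  ... | no  k≮n = ⊥-elim (k≮n (toℕ<n k))

  perm< : ∀ i → i < n → perm i < n
  perm< i i<n with i <? n
  ... | yes _   = toℕ<n _
  ... | no  i≮n = ⊥-elim (i≮n i<n)

  perm⁻¹< : ∀ i → i < n → perm⁻¹ i < n
  perm⁻¹< i i<n with i <? n
  ... | yes _   = toℕ<n _
  ... | no  i≮n = ⊥-elim (i≮n i<n)

  perm⁻¹-perm : ∀ i → i < n → perm⁻¹ (perm i) ≡ i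
  perm⁻¹-perm i i<n with i <? n
  ... | yes p = trans (perm⁻¹-toℕ (τ ⟨$⟩ʳ fromℕ< p)) (trans (cong toℕ (inverseˡ τ)) (toℕ-fromℕ< p))
  ... | no  i≮n = ⊥-elim (i≮n i<n)

  perm-perm⁻¹ : ∀ i → i < n → perm (perm⁻¹ i) ≡ i
  perm-perm⁻¹ i i<n with i <? n
  ... | yes p = trans (perm-toℕ (τ ⟨$⟩ˡ fromℕ< p)) (trans (cong toℕ (inverseʳ τ)) (toℕ-fromℕ< p))
  ... | no  i≮n = ⊥-elim (i≮n i<n)

  perm-injective : ∀ i j → i < n → j < n → perm i ≡ perm j → i ≡ j
  perm-injective i j i<n j<n e = trans (sym (perm⁻¹-perm i i<n)) (trans (cong perm⁻¹ e) (perm⁻¹-perm j j<n))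

  perm⁻¹-injective : ∀ i j → i < n → j < n → perm⁻¹ i ≡ perm⁻¹ j → i ≡ j
  perm⁻¹-injective i j i<n j<n e = trans (sym (perm-perm⁻¹ i i<n)) (trans (cong perm e) (perm-perm⁻¹ j j<n))

  oneLine-applyUpTo : oneLine τ ≡ applyUpTo (suc ∘ perm) n
  oneLine-applyUpTo = trans (map-tabulate id _)
    (trans (tabulate-cong (λ k → cong suc (sym (perm-toℕ k)))) (tabulate-toℕ n (suc ∘ perm)))

  singletonsInv-applyUpTo : singletonsInv τ ≡ applyUpTo (λ i → suc (perm⁻¹ i) ∷ []) n
  singletonsInv-applyUpTo = trans (map-tabulate id _)
    (trans (tabulate-cong (λ k → cong (λ z → suc z ∷ []) (sym (perm⁻¹-toℕ k))))
           (tabulate-toℕ n (λ i → suc (perm⁻¹ i) ∷ [])))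

length-singletonsInv : ∀ {n} (τ : Permutation′ n) → length (singletonsInv τ) ≡ n
length-singletonsInv {n} τ = trans (cong length (OnPositions.singletonsInv-applyUpTo τ)) (length-applyUpTo _ n)

bcount-sumBelow : ∀ (p : ℕ → Bool) (w : List ℕ) → bcount p w ≡ sumBelow (length w) (λ j → 𝟙 (p (nth 0 w j)))
bcount-sumBelow p []      = refl
bcount-sumBelow p (x ∷ w) with p x
... | true  = cong suc (bcount-sumBelow p w)
... | false = bcount-sumBelow p w

bcount-zip : ∀ (q : ℕ × ℕ → Bool) (f : ℕ → ℕ) (w : List ℕ) →
             bcount q (zip (applyUpTo f (length w)) w) ≡ sumBelow (length w) (λ j → 𝟙 (q (f j , nth 0 w j)))
bcount-zip q f []      = refl
bcount-zip q f (x ∷ w) with q (f 0 , x)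
... | true  = cong suc (bcount-zip q (f ∘ suc) w)
... | false = bcount-zip q (f ∘ suc) w

map-zip-applyUpTo : ∀ {B : Set} (h : ℕ × ℕ → B) (f : ℕ → ℕ) (w : List ℕ) →
                    map h (zip (applyUpTo f (length w)) w) ≡ applyUpTo (λ j → h (f j , nth 0 w j)) (length w)
map-zip-applyUpTo h f []      = refl
map-zip-applyUpTo h f (x ∷ w) = cong (h (f 0 , x) ∷_) (map-zip-applyUpTo h (f ∘ suc) w)

-- The standardization order: letter x at position j precedes letter y at position i.
precedes : ℕ → ℕ → ℕ → ℕ → Bool
precedes j x i y = (x <ᵇ y) ∨ ((j <ᵇ i) ∧ (x ≡ᵇ y))

precedes⁻ : ∀ j x i y → precedes j x i y ≡ true → x < y ⊎ (j < i × x ≡ y)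
precedes⁻ j x i y e with x <ᵇ y in x<y | j <ᵇ i in j<i | x ≡ᵇ y in x≡y
... | true  | _     | _     = inj₁ (<ᵇ-true⇒< x y x<y)
... | false | true  | true  = inj₂ (<ᵇ-true⇒< j i j<i , ≡ᵇ-true⇒≡ x y x≡y)

precedes-< : ∀ j x i y → x < y → precedes j x i y ≡ true
precedes-< j x i y x<y rewrite <⇒<ᵇ-true x y x<y = refl

precedes-≡ : ∀ j x i y → j < i → x ≡ y → precedes j x i y ≡ true
precedes-≡ j x i y j<i x≡y rewrite <⇒<ᵇ-true j i j<i | ≡⇒≡ᵇ-true x y x≡y = ∨-zeroʳ (x <ᵇ y)

precedes-irrefl : ∀ j x → precedes j x j x ≡ false
precedes-irrefl j x rewrite ≮⇒<ᵇ-false x x (<-irrefl refl) | ≮⇒<ᵇ-false j j (<-irrefl refl) = refl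

precedes-trans : ∀ a x b y c z → precedes a x b y ≡ true → precedes b y c z ≡ true → precedes a x c z ≡ true
precedes-trans a x b y c z p q with precedes⁻ a x b y p | precedes⁻ b y c z q
... | inj₁ x<y          | inj₁ y<z          = precedes-< a x c z (<-trans x<y y<z)
... | inj₁ x<y          | inj₂ (_ , refl)   = precedes-< a x c z x<y
... | inj₂ (_ , refl)   | inj₁ y<z          = precedes-< a x c z y<z
... | inj₂ (a<b , refl) | inj₂ (b<c , refl) = precedes-≡ a x c z (<-trans a<b b<c) refl

precedes-total : ∀ a x b y → a ≢ b → precedes a x b y ≡ false → precedes b y a x ≡ true
precedes-total a x b y a≢b ¬p with <-cmp x y
... | tri< x<y _ _ = contradiction (trans (sym ¬p) (precedes-< a x b y x<y)) λ ()
... | tri> _ _ y<x = precedes-< b y a x y<x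
... | tri≈ _ refl _ with <-cmp a b
...   | tri< a<b _ _ = contradiction (trans (sym ¬p) (precedes-≡ a x b x a<b refl)) λ ()
...   | tri≈ _ a≡b _ = ⊥-elim (a≢b a≡b)
...   | tri> _ _ b<a = precedes-≡ b x a x b<a refl

𝟙-precedes : ∀ j x i y → 𝟙 (x <ᵇ y) + 𝟙 ((j <ᵇ i) ∧ (x ≡ᵇ y)) ≡ 𝟙 (precedes j x i y)
𝟙-precedes j x i y with x <ᵇ y in x<y
... | true rewrite ≢⇒≡ᵇ-false x y (<⇒≢ (<ᵇ-true⇒< x y x<y)) = cong (suc ∘ 𝟙) (∧-zeroʳ (j <ᵇ i))
... | false = refl

rank : List ℕ → ℕ → ℕ
rank w i = sumBelow (length w) (λ j → 𝟙 (precedes j (nth 0 w j) i (nth 0 w i)))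

std-rank : ∀ w → std w ≡ applyUpTo (suc ∘ rank w) (length w)
std-rank w = trans (map-zip-applyUpTo _ id w) (applyUpTo-cong (length w) _ _ λ i _ → cong suc (begin
    bcount _ w + bcount _ (zip (upTo (length w)) w)
  ≡⟨ cong₂ _+_ (bcount-sumBelow _ w) (bcount-zip _ id w) ⟩
    sumBelow (length w) _ + sumBelow (length w) _
  ≡⟨ sumBelow-+ (length w) _ _ ⟩
    sumBelow (length w) _
  ≡⟨ sumBelow-cong (length w) _ _ (λ j _ → 𝟙-precedes j (nth 0 w j) i (nth 0 w i)) ⟩
    rank w i
  ∎))
  where open ≡-Reasoning

module _ {n : ℕ} (τ : Permutation′ n) where
  open OnPositions τ

  Increasing : List ℕ → Set
  Increasing w = ∀ a b → a < n → b < n → precedes a (nth 0 w a) b (nth 0 w b) ≡ true → perm a < perm b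

  sumBelow-perm< : ∀ t → t ≤ n → sumBelow n (λ j → 𝟙 (perm j <ᵇ t)) ≡ t
  sumBelow-perm< zero    _   = sumBelow-zero n _ (λ j → refl)
  sumBelow-perm< (suc t) t<n = begin
      sumBelow n (λ j → 𝟙 (perm j <ᵇ suc t))
    ≡⟨ sumBelow-cong n _ _ (λ j _ → 𝟙-<ᵇ-suc (perm j) t) ⟩
      sumBelow n (λ j → 𝟙 (perm j <ᵇ t) + 𝟙 (perm j ≡ᵇ t))
    ≡⟨ sym (sumBelow-+ n _ _) ⟩
      sumBelow n (λ j → 𝟙 (perm j <ᵇ t)) + sumBelow n (λ j → 𝟙 (perm j ≡ᵇ t))
    ≡⟨ cong₂ _+_ (sumBelow-perm< t (<⇒≤ t<n)) (sumBelow-cong n _ _ hit) ⟩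
      t + sumBelow n (λ j → 𝟙 (j ≡ᵇ perm⁻¹ t))
    ≡⟨ cong (t +_) (sumBelow-δ n (perm⁻¹ t) (perm⁻¹< t t<n)) ⟩
      t + 1
    ≡⟨ +-comm t 1 ⟩
      suc t
    ∎
    where
    open ≡-Reasoning
    hit : ∀ j → j < n → 𝟙 (perm j ≡ᵇ t) ≡ 𝟙 (j ≡ᵇ perm⁻¹ t)
    hit j j<n with perm j ≟ t
    ... | yes refl rewrite ≡⇒≡ᵇ-true (perm j) (perm j) refl
                         | ≡⇒≡ᵇ-true j (perm⁻¹ (perm j)) (sym (perm⁻¹-perm j j<n)) = refl
    ... | no  ≢t   rewrite ≢⇒≡ᵇ-false (perm j) t ≢t
                         | ≢⇒≡ᵇ-false j (perm⁻¹ t) (λ e → ≢t (trans (cong perm e) (perm-perm⁻¹ t t<n))) = refl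

  std≡⇒Increasing : ∀ w → std w ≡ oneLine τ → length w ≡ n × Increasing w
  std≡⇒Increasing w e
    with applyUpTo-injective 0 (length w) n _ _ (trans (sym (std-rank w)) (trans e oneLine-applyUpTo))
  ... | |w|≡n , suc-rank≡ = |w|≡n , increasing
    where
    rank≡perm : ∀ i → i < n → rank w i ≡ perm i
    rank≡perm i i<n = suc-injective (suc-rank≡ i (subst (i <_) (sym |w|≡n) i<n))
    increasing : Increasing w
    increasing a b a<n b<n a≺b = subst₂ _<_ (rank≡perm a a<n) (rank≡perm b b<n)
      (sumBelow-mono-< (length w) _ _
         (λ j _ → 𝟙-mono _ _ (λ j≺a → precedes-trans j (nth 0 w j) a (nth 0 w a) b (nth 0 w b) j≺a a≺b))
         a (subst (a <_) (sym |w|≡n) a<n) (𝟙-false<𝟙-true _ _ (precedes-irrefl a (nth 0 w a)) a≺b))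

  Increasing⇒std≡ : ∀ w → length w ≡ n → Increasing w → std w ≡ oneLine τ
  Increasing⇒std≡ w refl increasing =
    trans (std-rank w) (trans (applyUpTo-cong n _ _ (λ i i<n → cong suc (rank≡perm i i<n))) (sym oneLine-applyUpTo))
    where
    𝟙-precedes≡𝟙-perm< : ∀ i j → i < n → j < n →
                         𝟙 (precedes j (nth 0 w j) i (nth 0 w i)) ≡ 𝟙 (perm j <ᵇ perm i)
    𝟙-precedes≡𝟙-perm< i j i<n j<n with precedes j (nth 0 w j) i (nth 0 w i) in j≺i
    ... | true rewrite <⇒<ᵇ-true _ _ (increasing j i j<n i<n j≺i) = refl
    ... | false with j ≟ i
    ...   | yes refl rewrite ≮⇒<ᵇ-false (perm j) (perm j) (<-irrefl refl) = refl
    ...   | no  j≢i  rewrite ≮⇒<ᵇ-false (perm j) (perm i)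
                               (λ q → <-asym q (increasing i j i<n j<n (precedes-total j (nth 0 w j) i (nth 0 w i) j≢i j≺i))) = refl
    rank≡perm : ∀ i → i < n → rank w i ≡ perm i
    rank≡perm i i<n = trans (sumBelow-cong n _ _ (λ j j<n → 𝟙-precedes≡𝟙-perm< i j i<n j<n))
                            (sumBelow-perm< (perm i) (<⇒≤ (perm< i i<n)))

fibre : ℕ → (ℕ → ℕ) → ℕ → List ℕ
fibre L h v = bfilter (λ j → h j ≡ᵇ v) (upTo L)

-- packed x counts the distinct letters of h below x, so pack is the packed word of h.
module Packing (L : ℕ) (h : ℕ → ℕ) where

  occurs : ℕ → Bool
  occurs v = nonempty (fibre L h v)

  packed : ℕ → ℕ
  packed zero    = 0
  packed (suc x) = packed x + 𝟙 (occurs x)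

  pack : ℕ → ℕ
  pack j = packed (h j)

  occurs-letter : ∀ j → j < L → occurs (h j) ≡ true
  occurs-letter j j<L =
    ∈⇒nonempty _ j (∈-bfilter-applyUpTo⁺ L id (λ i → h i ≡ᵇ h j) j j<L (≡⇒≡ᵇ-true (h j) (h j) refl))

  occurs⇒letter : ∀ v → occurs v ≡ true → ∃[ j ] (j < L × h j ≡ v)
  occurs⇒letter v e with nonempty⇒∈ _ e
  ... | x , x∈ with ∈-bfilter-applyUpTo⁻ L id (λ i → h i ≡ᵇ v) x x∈
  ... | i , i<L , refl , hi≡v = i , i<L , ≡ᵇ-true⇒≡ _ _ hi≡v

  ¬letter⇒¬occurs : ∀ v → ¬ (∃[ j ] (j < L × h j ≡ v)) → occurs v ≡ false
  ¬letter⇒¬occurs v ¬letter with occurs v in e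
  ... | true  = ⊥-elim (¬letter (occurs⇒letter v e))
  ... | false = refl

  packed-mono-≤ : ∀ x y → x ≤ y → packed x ≤ packed y
  packed-mono-≤ zero    y       _   = z≤n
  packed-mono-≤ (suc x) (suc y) x≤y with m≤n⇒m<n∨m≡n x≤y
  ... | inj₂ refl      = ≤-refl
  ... | inj₁ (s≤s x≤y) = ≤-trans (packed-mono-≤ (suc x) y x≤y) (m≤m+n (packed y) _)

  packed-suc-occurs : ∀ x → occurs x ≡ true → packed (suc x) ≡ suc (packed x)
  packed-suc-occurs x e rewrite e = +-comm (packed x) 1

  packed-suc-¬occurs : ∀ x → occurs x ≡ false → packed (suc x) ≡ packed x
  packed-suc-¬occurs x e rewrite e = +-identityʳ (packed x)

  packed-mono-< : ∀ x y → occurs x ≡ true → x < y → packed x < packed y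
  packed-mono-< x y e x<y = subst (_≤ packed y) (packed-suc-occurs x e) (packed-mono-≤ (suc x) y x<y)

  packed-constant : ∀ x y → x ≤ y → (∀ v → x ≤ v → v < y → occurs v ≡ false) → packed y ≡ packed x
  packed-constant x zero    z≤n _ = refl
  packed-constant x (suc y) x≤y gap with m≤n⇒m<n∨m≡n x≤y
  ... | inj₂ refl      = refl
  ... | inj₁ (s≤s x≤y) = trans (packed-suc-¬occurs y (gap y x≤y ≤-refl))
                               (packed-constant x y x≤y (λ v x≤v v<y → gap v x≤v (≤-trans v<y (n≤1+n y))))

  packed-surjective : ∀ y r → r < packed y → ∃[ v ] (v < y × occurs v ≡ true × packed v ≡ r)
  packed-surjective (suc y) r r< with occurs y in e
  ... | false with packed-surjective y r (subst (r <_) (+-identityʳ (packed y)) r<)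
  ...   | v , v<y , occ , pv = v , ≤-trans v<y (n≤1+n y) , occ , pv
  packed-surjective (suc y) r r< | true with m≤n⇒m<n∨m≡n (subst (r <_) (+-comm (packed y) 1) r<)
  ... | inj₂ refl      = y , ≤-refl , e , refl
  ... | inj₁ (s≤s r<) with packed-surjective y r r<
  ...   | v , v<y , occ , pv = v , ≤-trans v<y (n≤1+n y) , occ , pv

  pack-mono-< : ∀ j k → j < L → h j < h k → pack j < pack k
  pack-mono-< j k j<L = packed-mono-< (h j) (h k) (occurs-letter j j<L)

  pack-injective : ∀ j k → j < L → k < L → pack j ≡ pack k → h j ≡ h k
  pack-injective j k j<L k<L e with <-cmp (h j) (h k)
  ... | tri< hj<hk _ _ = ⊥-elim (<-irrefl e (pack-mono-< j k j<L hj<hk))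
  ... | tri≈ _ hj≡hk _ = hj≡hk
  ... | tri> _ _ hk<hj = ⊥-elim (<-irrefl (sym e) (pack-mono-< k j k<L hk<hj))

  fibre-pack : ∀ v → occurs v ≡ true → fibre L h v ≡ fibre L pack (packed v)
  fibre-pack v occ = bfilter-cong-applyUpTo L id _ _ same
    where
    same : ∀ j → j < L → (h j ≡ᵇ v) ≡ (packed (h j) ≡ᵇ packed v)
    same j j<L with <-cmp (h j) v
    ... | tri≈ _ hj≡v _ rewrite ≡⇒≡ᵇ-true _ _ hj≡v | ≡⇒≡ᵇ-true _ _ (cong packed hj≡v) = refl
    ... | tri< hj<v _ _ rewrite ≢⇒≡ᵇ-false _ _ (<⇒≢ hj<v)
                              | ≢⇒≡ᵇ-false _ _ (<⇒≢ (packed-mono-< (h j) v (occurs-letter j j<L) hj<v)) = refl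
    ... | tri> _ _ v<hj rewrite ≢⇒≡ᵇ-false _ _ (>⇒≢ v<hj)
                              | ≢⇒≡ᵇ-false _ _ (>⇒≢ (packed-mono-< v (h j) occ v<hj)) = refl

  -- f is b +_ up to propositional equality, so that the recursive call can use f ∘ suc for suc b +_.
  nonempty-fibres : ∀ m b (f : ℕ → ℕ) → (∀ i → i < m → f i ≡ b + i) →
    bfilter nonempty (map (fibre L h) (applyUpTo f m))
      ≡ applyUpTo (λ r → fibre L pack (packed b + r)) (packed (b + m) ∸ packed b)
  nonempty-fibres zero b f _ rewrite +-identityʳ b | n∸n≡0 (packed b) = refl
  nonempty-fibres (suc m) b f f≡ rewrite trans (f≡ 0 (s≤s z≤n)) (+-identityʳ b) with occurs b in occ
  ... | true = begin
        fibre L h b ∷ bfilter nonempty (map (fibre L h) (applyUpTo (f ∘ suc) m))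
      ≡⟨ cong₂ _∷_ (trans (fibre-pack b occ) (cong (fibre L pack) (sym (+-identityʳ (packed b)))))
                   (nonempty-fibres m (suc b) (f ∘ suc) f∘suc≡) ⟩
        fibre L pack (packed b + 0)
          ∷ applyUpTo (λ r → fibre L pack (packed (suc b) + r)) (packed (suc b + m) ∸ packed (suc b))
      ≡⟨ cong (fibre L pack (packed b + 0) ∷_) (trans
           (cong (λ z → applyUpTo (λ r → fibre L pack (z + r)) (packed (suc b + m) ∸ z)) (packed-suc-occurs b occ))
           (applyUpTo-cong _ _ _ (λ r _ → cong (fibre L pack) (sym (+-suc (packed b) r))))) ⟩
        applyUpTo (λ r → fibre L pack (packed b + r)) (suc (packed (suc b + m) ∸ suc (packed b)))
      ≡⟨ cong (applyUpTo (λ r → fibre L pack (packed b + r))) (sym count) ⟩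
        applyUpTo (λ r → fibre L pack (packed b + r)) (packed (b + suc m) ∸ packed b)
      ∎
    where
    open ≡-Reasoning
    f∘suc≡ : ∀ i → i < m → f (suc i) ≡ suc b + i
    f∘suc≡ i i<m = trans (f≡ (suc i) (s≤s i<m)) (+-suc b i)
    count : packed (b + suc m) ∸ packed b ≡ suc (packed (suc b + m) ∸ suc (packed b))
    count rewrite +-suc b m = m∸n≡suc[m∸[1+n]] _ _
      (packed-mono-< b (suc b + m) occ (s≤s (m≤m+n b m)))
  ... | false = trans (nonempty-fibres m (suc b) (f ∘ suc) (λ i i<m → trans (f≡ (suc i) (s≤s i<m)) (+-suc b i)))
      (trans (cong (λ z → applyUpTo (λ r → fibre L pack (z + r)) (packed (suc b + m) ∸ z)) (packed-suc-¬occurs b occ))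
             (cong (λ k → applyUpTo (λ r → fibre L pack (packed b + r)) (packed k ∸ packed b)) (sym (+-suc b m))))

∈-fibre⁺ : ∀ L (f : ℕ → ℕ) j → j < L → j ∈ fibre L f (f j)
∈-fibre⁺ L f j j<L = ∈-bfilter-applyUpTo⁺ L id _ j j<L (≡⇒≡ᵇ-true (f j) (f j) refl)

∈-fibre⁻ : ∀ L (f : ℕ → ℕ) v j → j ∈ fibre L f v → j < L × f j ≡ v
∈-fibre⁻ L f v j j∈ with ∈-bfilter-applyUpTo⁻ L id _ j j∈
... | _ , j<L , refl , fj≡v = j<L , ≡ᵇ-true⇒≡ _ _ fj≡v

fibres-injective : ∀ L n K K′ (f g : ℕ → ℕ) → (∀ j → j < L → f j < K) → (∀ j → j < n → g j < K′) →
  applyUpTo (fibre L f) K ≡ applyUpTo (fibre n g) K′ → L ≡ n × K ≡ K′ × (∀ j → j < L → f j ≡ g j)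
fibres-injective L n K K′ f g f<K g<K′ e with applyUpTo-injective [] K K′ _ _ e
... | K≡K′ , same = L≡n , K≡K′ , λ j j<L → sym (proj₂ (transfer j j<L))
  where
  transfer : ∀ j → j < L → j < n × g j ≡ f j
  transfer j j<L = ∈-fibre⁻ n g (f j) j (subst (j ∈_) (same (f j) (f<K j j<L)) (∈-fibre⁺ L f j j<L))
  transfer′ : ∀ j → j < n → j < L
  transfer′ j j<n = proj₁ (∈-fibre⁻ L f (g j) j
    (subst (j ∈_) (sym (same (g j) (subst (g j <_) (sym K≡K′) (g<K′ j j<n)))) (∈-fibre⁺ n g j j<n)))
  L≡n : L ≡ n
  L≡n = ≤-antisym (≮⇒≥ (λ n<L → <-irrefl refl (proj₁ (transfer n n<L)))) (≮⇒≥ (λ L<n → <-irrefl refl (transfer′ L L<n)))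

fibres-cong : ∀ n K (f g : ℕ → ℕ) → (∀ j → j < n → f j ≡ g j) → applyUpTo (fibre n f) K ≡ applyUpTo (fibre n g) K
fibres-cong n K f g f≗g =
  applyUpTo-cong K _ _ (λ r _ → bfilter-cong-applyUpTo n id _ _ (λ j j<n → cong (_≡ᵇ r) (f≗g j j<n)))

block-fibre : ∀ v (f : ℕ → ℕ) (w : List ℕ) →
  map proj₁ (bfilter (λ ia → proj₂ ia ≡ᵇ v) (zip (applyUpTo f (length w)) w)) ≡ map f (fibre (length w) (nth 0 w) v)
block-fibre v f []      = refl
block-fibre v f (x ∷ w) with x ≡ᵇ v
... | true  = cong (f 0 ∷_) (trans (block-fibre v (f ∘ suc) w)
                (trans (map-∘ _) (cong (map f) (sym (bfilter-positions _ (length w))))))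
... | false = trans (block-fibre v (f ∘ suc) w) (trans (map-∘ _) (cong (map f) (sym (bfilter-positions _ (length w)))))

anyB-occurs : ∀ v (w : List ℕ) → anyB (λ a → v ≡ᵇ a) w ≡ nonempty (fibre (length w) (nth 0 w) v)
anyB-occurs v []      = refl
anyB-occurs v (x ∷ w) rewrite ≡ᵇ-sym v x with x ≡ᵇ v
... | true  = refl
... | false = trans (anyB-occurs v w)
                (trans (sym (nonempty-map suc _)) (cong nonempty (sym (bfilter-positions _ (length w)))))

ϱ-packed : ∀ w → let open Packing (length w) (nth 0 w) in
           ϱ w ≡ map (map suc) (applyUpTo (fibre (length w) pack) (packed (suc (maxL w))))
ϱ-packed w = begin
    map (block w) (bfilter (λ v → anyB (λ a → v ≡ᵇ a) w) values)
  ≡⟨ map-bfilter-nonempty _ (block w) values (λ v →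
       trans (anyB-occurs v w) (trans (sym (nonempty-map suc _)) (cong nonempty (sym (block-fibre v suc w))))) ⟩
    bfilter nonempty (map (block w) values)
  ≡⟨ cong (bfilter nonempty) (trans (map-cong (λ v → block-fibre v suc w) values) (map-∘ values)) ⟩
    bfilter nonempty (map (map suc) (map (fibre (length w) (nth 0 w)) values))
  ≡⟨ bfilter-nonempty-map suc (map (fibre (length w) (nth 0 w)) values) ⟩
    map (map suc) (bfilter nonempty (map (fibre (length w) (nth 0 w)) values))
  ≡⟨ cong (map (map suc)) (Packing.nonempty-fibres (length w) (nth 0 w) (suc (maxL w)) 0 id (λ i _ → refl)) ⟩
    map (map suc) (applyUpTo (fibre (length w) (Packing.pack (length w) (nth 0 w)))
                             (Packing.packed (length w) (nth 0 w) (suc (maxL w))))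
  ∎
  where
  open ≡-Reasoning
  values : List ℕ
  values = upTo (suc (maxL w))
  block : List ℕ → ℕ → List ℕ
  block w v = map proj₁ (bfilter (λ ia → proj₂ ia ≡ᵇ v) (zip (positions (length w)) w))

Step : ℕ → ℕ → Set
Step a b = b ≡ a ⊎ b ≡ suc a

Step⇒≤ : ∀ {a b} → Step a b → a ≤ b
Step⇒≤ (inj₁ refl) = ≤-refl
Step⇒≤ (inj₂ refl) = n≤1+n _

StepsFrom : ℕ → List ℕ → Set
StepsFrom c []      = ⊤
StepsFrom c (d ∷ x) = Step c d × StepsFrom d x

∈-colSeqsFrom⁻ : ∀ k c x → x ∈ colSeqsFrom k c → length x ≡ k × StepsFrom c x
∈-colSeqsFrom⁻ zero    c x (here refl) = refl , tt
∈-colSeqsFrom⁻ (suc k) c x x∈ with ∈-++⁻ (map (c ∷_) (colSeqsFrom k c)) x∈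
... | inj₁ x∈stay with ∈-map⁻ (c ∷_) x∈stay
...   | y , y∈ , refl = let |y| , steps = ∈-colSeqsFrom⁻ k c y y∈ in cong suc |y| , inj₁ refl , steps
∈-colSeqsFrom⁻ (suc k) c x x∈ | inj₂ x∈move with ∈-map⁻ (suc c ∷_) x∈move
...   | y , y∈ , refl = let |y| , steps = ∈-colSeqsFrom⁻ k (suc c) y y∈ in cong suc |y| , inj₂ refl , steps

_≡ᵇₗ_ : List ℕ → List ℕ → Bool
[]      ≡ᵇₗ []      = true
(a ∷ x) ≡ᵇₗ (b ∷ y) = (a ≡ᵇ b) ∧ (x ≡ᵇₗ y)
[]      ≡ᵇₗ (_ ∷ _) = false
(_ ∷ _) ≡ᵇₗ []      = false

≡ᵇₗ-refl : ∀ x → (x ≡ᵇₗ x) ≡ true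
≡ᵇₗ-refl []      = refl
≡ᵇₗ-refl (a ∷ x) rewrite ≡⇒≡ᵇ-true a a refl = ≡ᵇₗ-refl x

≡ᵇₗ-true⇒≡ : ∀ x y → (x ≡ᵇₗ y) ≡ true → x ≡ y
≡ᵇₗ-true⇒≡ []      []      _ = refl
≡ᵇₗ-true⇒≡ (a ∷ x) (b ∷ y) e with a ≡ᵇ b in a≡b
... | true = cong₂ _∷_ (≡ᵇ-true⇒≡ a b a≡b) (≡ᵇₗ-true⇒≡ x y e)

count : List ℕ → List (List ℕ) → ℕ
count x xs = sum (map (λ y → 𝟙 (y ≡ᵇₗ x)) xs)

count-++ : ∀ x xs ys → count x (xs ++ ys) ≡ count x xs + count x ys
count-++ x xs ys = trans (cong sum (map-++ _ xs ys)) (sum-++ (map _ xs) _)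

count-map-∷ : ∀ c d x ys → count (d ∷ x) (map (c ∷_) ys) ≡ (if c ≡ᵇ d then count x ys else 0)
count-map-∷ c d x [] with c ≡ᵇ d
... | true  = refl
... | false = refl
count-map-∷ c d x (y ∷ ys) with c ≡ᵇ d in c≡d
... | true  = cong (𝟙 (y ≡ᵇₗ x) +_) (trans (count-map-∷ c d x ys) (cong (λ b → if b then count x ys else 0) c≡d))
... | false = trans (count-map-∷ c d x ys) (cong (λ b → if b then count x ys else 0) c≡d)

count-map-∷-≡ : ∀ c x ys → count (c ∷ x) (map (c ∷_) ys) ≡ count x ys
count-map-∷-≡ c x ys rewrite count-map-∷ c c x ys | ≡⇒≡ᵇ-true c c refl = refl

count-map-∷-≢ : ∀ c d x ys → c ≢ d → count (d ∷ x) (map (c ∷_) ys) ≡ 0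
count-map-∷-≢ c d x ys c≢d rewrite count-map-∷ c d x ys | ≢⇒≡ᵇ-false c d c≢d = refl

count-colSeqsFrom : ∀ k c x → length x ≡ k → StepsFrom c x → count x (colSeqsFrom k c) ≡ 1
count-colSeqsFrom zero    c []      refl tt = refl
count-colSeqsFrom (suc k) c (d ∷ x) |x| (step , steps) =
  trans (count-++ (d ∷ x) (map (c ∷_) (colSeqsFrom k c)) _) (cases step)
  where
  rest : ∀ d → StepsFrom d x → count x (colSeqsFrom k d) ≡ 1
  rest d = count-colSeqsFrom k d x (suc-injective |x|)
  cases : Step c d → count (d ∷ x) (map (c ∷_) (colSeqsFrom k c)) + count (d ∷ x) (map (suc c ∷_) (colSeqsFrom k (suc c))) ≡ 1
  cases (inj₁ refl) rewrite count-map-∷-≡ c x (colSeqsFrom k c) | rest c steps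
    | count-map-∷-≢ (suc c) c x (colSeqsFrom k (suc c)) 1+n≢n = refl
  cases (inj₂ refl) rewrite count-map-∷-≢ c (suc c) x (colSeqsFrom k c) (1+n≢n ∘ sym)
    | count-map-∷-≡ (suc c) x (colSeqsFrom k (suc c)) | rest (suc c) steps = refl

record IsColumnSequence (n : ℕ) (F : List ℕ) : Set where
  field
    length≡ : length F ≡ n
    starts-at-1 : 0 < n → nth 0 F 0 ≡ 1
    steps : ∀ i → suc i < n → Step (nth 0 F i) (nth 0 F (suc i))

  monotone : ∀ i k → i ≤ k → k < n → nth 0 F i ≤ nth 0 F k
  monotone i zero    z≤n _   = ≤-refl
  monotone i (suc k) i≤k k<n with m≤n⇒m<n∨m≡n i≤k
  ... | inj₂ refl      = ≤-refl
  ... | inj₁ (s≤s i≤k) = ≤-trans (monotone i k i≤k (<-trans (n<1+n k) k<n)) (Step⇒≤ (steps k k<n))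

  positive : ∀ i → i < n → 1 ≤ nth 0 F i
  positive i i<n = subst (_≤ nth 0 F i) (starts-at-1 (≤-<-trans z≤n i<n)) (monotone 0 i z≤n i<n)

  ≤-maxL-entry : ∀ i → i < n → nth 0 F i ≤ maxL F
  ≤-maxL-entry i i<n = ≤-maxL F _ (nth-∈ 0 F i (subst (i <_) (sym length≡) i<n))

  pred-entry<maxL : ∀ i → i < n → pred (nth 0 F i) < maxL F
  pred-entry<maxL i i<n with nth 0 F i | positive i i<n | ≤-maxL-entry i i<n
  ... | suc _ | _ | Fi≤max = Fi≤max

  onto-below : ∀ k → k < n → ∀ v → 1 ≤ v → v ≤ nth 0 F k → ∃[ i ] (i < n × nth 0 F i ≡ v)
  onto-below zero    k<n v 1≤v v≤ = 0 , k<n , ≤-antisym (subst (_≤ v) (sym (starts-at-1 k<n)) 1≤v) v≤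
  onto-below (suc k) k<n v 1≤v v≤ with v ≤? nth 0 F k
  ... | yes v≤Fk = onto-below k (<-trans (n<1+n k) k<n) v 1≤v v≤Fk
  ... | no  v≰Fk with steps k k<n
  ...   | inj₁ stay = ⊥-elim (v≰Fk (subst (v ≤_) stay v≤))
  ...   | inj₂ move = suc k , k<n , ≤-antisym (subst (_≤ v) (sym move) (≰⇒> v≰Fk)) v≤

  onto : ∀ v → 1 ≤ v → v ≤ maxL F → ∃[ i ] (i < n × nth 0 F i ≡ v)
  onto v 1≤v v≤max with maxL-∈ F
  ... | inj₂ max≡0 = ⊥-elim (<-irrefl refl (≤-trans 1≤v (subst (v ≤_) max≡0 v≤max)))
  ... | inj₁ max∈ with ∈⇒nth 0 F (maxL F) max∈
  ...   | i , i<|F| , Fi≡max = onto-below i (subst (i <_) length≡ i<|F|) v 1≤v (subst (v ≤_) (sym Fi≡max) v≤max)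

StepsFrom⇒steps : ∀ c x → StepsFrom c x → ∀ i → suc i < suc (length x) → Step (nth 0 (c ∷ x) i) (nth 0 (c ∷ x) (suc i))
StepsFrom⇒steps c []      _              zero    (s≤s ())
StepsFrom⇒steps c (d ∷ x) (step , _)     zero    _         = step
StepsFrom⇒steps c (d ∷ x) (_ , steps)    (suc i) (s≤s i<n) = StepsFrom⇒steps d x steps i i<n

steps⇒StepsFrom : ∀ c x → (∀ i → suc i < suc (length x) → Step (nth 0 (c ∷ x) i) (nth 0 (c ∷ x) (suc i))) → StepsFrom c x
steps⇒StepsFrom c []      _     = tt
steps⇒StepsFrom c (d ∷ x) steps = steps 0 (s≤s (s≤s z≤n)) , steps⇒StepsFrom d x (λ i i<n → steps (suc i) (s≤s i<n))

∈-colSeqs⁻ : ∀ n F → F ∈ colSeqs n → IsColumnSequence n F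
∈-colSeqs⁻ zero    F (here refl) = record { length≡ = refl ; starts-at-1 = λ () ; steps = λ _ () }
∈-colSeqs⁻ (suc k) F F∈ with ∈-map⁻ (1 ∷_) F∈
... | x , x∈ , refl with ∈-colSeqsFrom⁻ k 1 x x∈
... | refl , steps = record { length≡ = refl ; starts-at-1 = λ _ → refl ; steps = StepsFrom⇒steps 1 x steps }

count-colSeqs : ∀ n F → IsColumnSequence n F → count F (colSeqs n) ≡ 1
count-colSeqs zero    []      _ = refl
count-colSeqs zero    (_ ∷ _) F-col with () ← IsColumnSequence.length≡ F-col
count-colSeqs (suc k) []      F-col with () ← IsColumnSequence.length≡ F-col
count-colSeqs (suc k) (d ∷ x) F-col with IsColumnSequence.length≡ F-col | IsColumnSequence.starts-at-1 F-col (s≤s z≤n)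
... | refl | refl = trans (count-map-∷-≡ 1 x (colSeqsFrom k 1))
  (count-colSeqsFrom k 1 x refl (steps⇒StepsFrom 1 x (IsColumnSequence.steps F-col)))

constant-run-ascending : ∀ {n F} → IsColumnSequence n F → (s : ℕ → ℕ) →
  (∀ i → suc i < n → nth 0 F i ≡ nth 0 F (suc i) → s i < s (suc i)) →
  ∀ a b → a < b → b < n → nth 0 F a ≡ nth 0 F b → s a < s b
constant-run-ascending {n} {F} F-col s ascent a (suc b) (s≤s a≤b) b<n Fa≡Fb with m≤n⇒m<n∨m≡n a≤b
... | inj₂ refl = ascent a b<n Fa≡Fb
... | inj₁ a<b  = <-trans (constant-run-ascending F-col s ascent a b a<b b′<n Fa≡Fb′)
                          (ascent b b<n (trans (sym Fa≡Fb′) Fa≡Fb))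
  where
  open IsColumnSequence F-col
  b′<n : b < n
  b′<n = <-trans (n<1+n b) b<n
  Fa≡Fb′ : nth 0 F a ≡ nth 0 F b
  Fa≡Fb′ = ≤-antisym (monotone a b (<⇒≤ a<b) b′<n)
                     (subst (nth 0 F b ≤_) (sym Fa≡Fb) (monotone b (suc b) (n≤1+n b) b<n))

anyB-column : ∀ (s : ℕ → ℕ) (F : List ℕ) p c →
  anyB (λ q → p ≡ᵇ q) (concat (map proj₁ (bfilter (λ Bc → proj₂ Bc ≡ᵇ c) (zip (applyUpTo (λ i → s i ∷ []) (length F)) F))))
    ≡ anyBelow (length F) (λ i → (nth 0 F i ≡ᵇ c) ∧ (p ≡ᵇ s i))
anyB-column s []      p c = refl
anyB-column s (x ∷ F) p c with x ≡ᵇ c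
... | true  = cong ((p ≡ᵇ s 0) ∨_) (anyB-column (s ∘ suc) F p c)
... | false = anyB-column (s ∘ suc) F p c

column : SetComp → List ℕ → ℕ → List ℕ
column Φ cs c = unionB (maxL (concat Φ)) (map proj₁ (bfilter (λ Bc → proj₂ Bc ≡ᵇ c) (zip Φ cs)))

validPairs⇒ : ∀ (B : ℕ → List ℕ) (F : List ℕ) → validPairs (zip (applyUpTo B (length F)) F) ≡ true →
  ∀ i → suc i < length F → (not (nth 0 F i ≡ᵇ nth 0 F (suc i)) ∨ (B i >D B (suc i))) ≡ true
validPairs⇒ B (c ∷ [])     v zero    (s≤s ())
validPairs⇒ B (c ∷ c′ ∷ F) v zero    _         = ∧-conicalˡ _ _ v
validPairs⇒ B (c ∷ c′ ∷ F) v (suc i) (s≤s i<n) = validPairs⇒ (B ∘ suc) (c′ ∷ F) (∧-conicalʳ _ _ v) i i<n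

⇒validPairs : ∀ (B : ℕ → List ℕ) (F : List ℕ) →
  (∀ i → suc i < length F → (not (nth 0 F i ≡ᵇ nth 0 F (suc i)) ∨ (B i >D B (suc i))) ≡ true) →
  validPairs (zip (applyUpTo B (length F)) F) ≡ true
⇒validPairs B []           h = refl
⇒validPairs B (c ∷ [])     h = refl
⇒validPairs B (c ∷ c′ ∷ F) h =
  cong₂ _∧_ (h 0 (s≤s (s≤s z≤n))) (⇒validPairs (B ∘ suc) (c′ ∷ F) (λ i i<n → h (suc i) (s≤s i<n)))

module SingletonFillings {n : ℕ} (τ : Permutation′ n) where
  open OnPositions τ

  Φ : SetComp
  Φ = applyUpTo (λ i → suc (perm⁻¹ i) ∷ []) n

  maxL-concat-Φ : maxL (concat Φ) ≡ n
  maxL-concat-Φ rewrite concat-singletons n (suc ∘ perm⁻¹) = maxL-≡ _ n bounded attained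
    where
    bounded : ∀ x → x ∈ applyUpTo (suc ∘ perm⁻¹) n → x ≤ n
    bounded x x∈ with ∈-applyUpTo⁻ (suc ∘ perm⁻¹) x∈
    ... | i , i<n , refl = perm⁻¹< i i<n
    attained : n ∈ applyUpTo (suc ∘ perm⁻¹) n ⊎ n ≡ 0
    attained with n ≟ 0
    ... | yes n≡0 = inj₂ n≡0
    ... | no  n≢0 = inj₁ (subst (_∈ applyUpTo (suc ∘ perm⁻¹) n)
                                (trans (cong suc (perm⁻¹-perm (pred n) pred-n<n)) suc-pred-n)
                                (∈-applyUpTo⁺ (suc ∘ perm⁻¹) (perm< (pred n) pred-n<n)))
      where
      suc-pred-n : suc (pred n) ≡ n
      suc-pred-n = suc-pred n {{≢-nonZero n≢0}}
      pred-n<n : pred n < n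
      pred-n<n = subst (pred n <_) suc-pred-n ≤-refl

  -- Position p lies in column c exactly when row τ(p), which holds the block {p}, is placed in column c.
  column-Φ : ∀ F c → length F ≡ n → column Φ F c ≡ map suc (fibre n (λ p → nth 0 F (perm p)) c)
  column-Φ F c refl rewrite maxL-concat-Φ =
    trans (bfilter-positions _ n) (cong (map suc) (bfilter-cong-applyUpTo n id _ _ member))
    where
    member : ∀ p → p < n →
      anyB (λ q → suc p ≡ᵇ q) (concat (map proj₁ (bfilter (λ Bc → proj₂ Bc ≡ᵇ c) (zip Φ F)))) ≡ (nth 0 F (perm p) ≡ᵇ c)
    member p p<n = begin
        anyB _ (concat (map proj₁ (bfilter _ (zip Φ F))))
      ≡⟨ anyB-column (suc ∘ perm⁻¹) F (suc p) c ⟩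
        anyBelow n (λ i → (nth 0 F i ≡ᵇ c) ∧ (p ≡ᵇ perm⁻¹ i))
      ≡⟨ anyBelow-unique n _ (perm p) (perm< p p<n) other ⟩
        (nth 0 F (perm p) ≡ᵇ c) ∧ (p ≡ᵇ perm⁻¹ (perm p))
      ≡⟨ cong ((nth 0 F (perm p) ≡ᵇ c) ∧_) (≡⇒≡ᵇ-true p _ (sym (perm⁻¹-perm p p<n))) ⟩
        (nth 0 F (perm p) ≡ᵇ c) ∧ true
      ≡⟨ ∧-identityʳ _ ⟩
        (nth 0 F (perm p) ≡ᵇ c)
      ∎
      where
      open ≡-Reasoning
      other : ∀ i → i < n → i ≢ perm p → ((nth 0 F i ≡ᵇ c) ∧ (p ≡ᵇ perm⁻¹ i)) ≡ false
      other i i<n i≢ rewrite ≢⇒≡ᵇ-false p (perm⁻¹ i) (λ e → i≢ (trans (sym (perm-perm⁻¹ i i<n)) (cong perm (sym e))))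
        = ∧-zeroʳ (nth 0 F i ≡ᵇ c)

  col-singletonsInv : ∀ F → length F ≡ n → (∀ i → i < n → 1 ≤ nth 0 F i) →
    (∀ v → 1 ≤ v → v ≤ maxL F → ∃[ i ] (i < n × nth 0 F i ≡ v)) →
    col (singletonsInv τ) F ≡ map (map suc) (applyUpTo (fibre n (λ p → pred (nth 0 F (perm p)))) (maxL F))
  col-singletonsInv F |F|≡n positive onto = begin
      col (singletonsInv τ) F
    ≡⟨ cong (λ Ψ → col Ψ F) singletonsInv-applyUpTo ⟩
      bfilter nonempty (map (column Φ F) (positions (maxL F)))
    ≡⟨ cong (bfilter nonempty) (map-cong (λ c → column-Φ F c |F|≡n) (positions (maxL F))) ⟩
      bfilter nonempty (map (map suc ∘ fibre n row) (positions (maxL F)))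
    ≡⟨ bfilter-all _ _ all-nonempty ⟩
      map (map suc ∘ fibre n row) (positions (maxL F))
    ≡⟨ map-applyUpTo suc _ (maxL F) ⟩
      applyUpTo (map suc ∘ fibre n row ∘ suc) (maxL F)
    ≡⟨ applyUpTo-cong (maxL F) _ _ (λ r _ → cong (map suc) (fibre-suc r)) ⟩
      applyUpTo (map suc ∘ fibre n (pred ∘ row)) (maxL F)
    ≡⟨ sym (map-applyUpTo _ (map suc) (maxL F)) ⟩
      map (map suc) (applyUpTo (fibre n (pred ∘ row)) (maxL F))
    ∎
    where
    open ≡-Reasoning
    row : ℕ → ℕ
    row p = nth 0 F (perm p)
    fibre-suc : ∀ r → fibre n row (suc r) ≡ fibre n (pred ∘ row) r
    fibre-suc r = bfilter-cong-applyUpTo n id _ _ same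
      where
      same : ∀ p → p < n → (row p ≡ᵇ suc r) ≡ (pred (row p) ≡ᵇ r)
      same p p<n with row p | positive (perm p) (perm< p p<n)
      ... | suc _ | _ = refl
    all-nonempty : ∀ x → x ∈ map (map suc ∘ fibre n row) (positions (maxL F)) → nonempty x ≡ true
    all-nonempty x x∈ with ∈-map⁻ _ x∈
    ... | c , c∈ , refl with ∈-applyUpTo⁻ suc c∈
    ... | r , r<max , refl with onto (suc r) (s≤s z≤n) r<max
    ... | i , i<n , Fi≡ = trans (nonempty-map suc _) (∈⇒nonempty _ (perm⁻¹ i)
            (∈-bfilter-applyUpTo⁺ n id _ (perm⁻¹ i) (perm⁻¹< i i<n)
              (≡⇒≡ᵇ-true _ _ (trans (cong (nth 0 F) (perm-perm⁻¹ i i<n)) Fi≡))))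

  -- For singletons, {a} >_D {b} computes to a <ᵇ b.
  valid-singletonsInv⇒ : ∀ F → length F ≡ n → valid (singletonsInv τ) F ≡ true →
    ∀ i → suc i < n → nth 0 F i ≡ nth 0 F (suc i) → perm⁻¹ i < perm⁻¹ (suc i)
  valid-singletonsInv⇒ F refl v i i<n Fi≡ = <ᵇ-true⇒< _ _
    (subst (λ b → (not b ∨ (perm⁻¹ i <ᵇ perm⁻¹ (suc i))) ≡ true) (≡⇒≡ᵇ-true _ _ Fi≡)
      (validPairs⇒ (λ i → suc (perm⁻¹ i) ∷ []) F (subst (λ Ψ → validPairs (zip Ψ F) ≡ true) singletonsInv-applyUpTo v) i i<n))

  valid-singletonsInv⇐ : ∀ F → length F ≡ n →
    (∀ i → suc i < n → nth 0 F i ≡ nth 0 F (suc i) → perm⁻¹ i < perm⁻¹ (suc i)) → valid (singletonsInv τ) F ≡ true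
  valid-singletonsInv⇐ F refl ascent =
    subst (λ Ψ → validPairs (zip Ψ F) ≡ true) (sym singletonsInv-applyUpTo) (⇒validPairs _ F pair)
    where
    pair : ∀ i → suc i < length F → (not (nth 0 F i ≡ᵇ nth 0 F (suc i)) ∨ (perm⁻¹ i <ᵇ perm⁻¹ (suc i))) ≡ true
    pair i i<n with nth 0 F i ≡ᵇ nth 0 F (suc i) in Fi≡
    ... | false = refl
    ... | true  = <⇒<ᵇ-true _ _ (ascent i i<n (≡ᵇ-true⇒≡ _ _ Fi≡))

module Matching {n : ℕ} (τ : Permutation′ n) (w : Word) where
  open OnPositions τ
  open SingletonFillings τ using (col-singletonsInv; valid-singletonsInv⇒; valid-singletonsInv⇐)
  open Packing (length w) (nth 0 w)

  letters : ℕ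
  letters = packed (suc (maxL w))

  pack<letters : ∀ j → j < length w → pack j < letters
  pack<letters j j<L = packed-mono-< _ _ (occurs-letter j j<L) (s≤s (≤-maxL w _ (nth-∈ 0 w j j<L)))

  -- The block {j+1} sits in row τ(j); it must go to the column numbered by the packed letter at j.
  Matches : List ℕ → Set
  Matches F = length w ≡ n × (∀ j → j < n → nth 0 F (perm j) ≡ suc (pack j))

  ϱ≡col⇒same-fibres : ∀ F → IsColumnSequence n F → ϱ w ≡ col (singletonsInv τ) F →
    length w ≡ n × letters ≡ maxL F × (∀ j → j < length w → pack j ≡ pred (nth 0 F (perm j)))
  ϱ≡col⇒same-fibres F F-col e = fibres-injective (length w) n letters (maxL F) pack (pred ∘ nth 0 F ∘ perm)
    pack<letters (λ j j<n → pred-entry<maxL (perm j) (perm< j j<n)) (map-injective (map-injective suc-injective)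
      (trans (sym (ϱ-packed w)) (trans e (col-singletonsInv F length≡ positive onto))))
    where open IsColumnSequence F-col

  ϱ≡col⇒Matches : ∀ F → IsColumnSequence n F → ϱ w ≡ col (singletonsInv τ) F → Matches F
  ϱ≡col⇒Matches F F-col e with ϱ≡col⇒same-fibres F F-col e
  ... | L≡n , _ , pack≡ = L≡n , λ j j<n → begin
      nth 0 F (perm j)                 ≡⟨ sym (suc-pred _ {{>-nonZero (positive (perm j) (perm< j j<n))}}) ⟩
      suc (pred (nth 0 F (perm j)))    ≡⟨ cong suc (sym (pack≡ j (subst (j <_) (sym L≡n) j<n))) ⟩
      suc (pack j)                     ∎
    where
    open ≡-Reasoning
    open IsColumnSequence F-col

  Matches⇒ϱ≡col : ∀ F → IsColumnSequence n F → Matches F → ϱ w ≡ col (singletonsInv τ) F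
  Matches⇒ϱ≡col F F-col (refl , F∘perm≡) = begin
      ϱ w
    ≡⟨ ϱ-packed w ⟩
      map (map suc) (applyUpTo (fibre n pack) letters)
    ≡⟨ cong (map (map suc)) (fibres-cong n letters pack _ (λ j j<n → cong pred (sym (F∘perm≡ j j<n)))) ⟩
      map (map suc) (applyUpTo (fibre n (pred ∘ nth 0 F ∘ perm)) letters)
    ≡⟨ cong (λ K → map (map suc) (applyUpTo (fibre n (pred ∘ nth 0 F ∘ perm)) K)) (sym maxL-F) ⟩
      map (map suc) (applyUpTo (fibre n (pred ∘ nth 0 F ∘ perm)) (maxL F))
    ≡⟨ sym (col-singletonsInv F length≡ positive onto) ⟩
      col (singletonsInv τ) F
    ∎
    where
    open ≡-Reasoning
    open IsColumnSequence F-col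
    F≡ : ∀ i → i < n → nth 0 F i ≡ suc (pack (perm⁻¹ i))
    F≡ i i<n = trans (cong (nth 0 F) (sym (perm-perm⁻¹ i i<n))) (F∘perm≡ (perm⁻¹ i) (perm⁻¹< i i<n))
    bounded : ∀ x → x ∈ F → x ≤ letters
    bounded x x∈ with ∈⇒nth 0 F x x∈
    ... | i , i<|F| , refl = let i<n = subst (i <_) length≡ i<|F| in
      subst (_≤ letters) (sym (F≡ i i<n)) (pack<letters (perm⁻¹ i) (perm⁻¹< i i<n))
    attained : letters ∈ F ⊎ letters ≡ 0
    attained with letters in K≡
    ... | zero  = inj₂ refl
    ... | suc k with packed-surjective (suc (maxL w)) k (subst (k <_) (sym K≡) ≤-refl)
    ...   | v , _ , occ , packed-v≡k with occurs⇒letter v occ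
    ...     | j , j<n , refl = inj₁ (subst (_∈ F) (trans (F∘perm≡ j j<n) (cong suc packed-v≡k))
                                         (nth-∈ 0 F (perm j) (subst (perm j <_) (sym length≡) (perm< j j<n))))
    maxL-F : maxL F ≡ letters
    maxL-F = maxL-≡ F letters bounded attained

  Matches-valid⇒std≡ : ∀ F → IsColumnSequence n F → valid (singletonsInv τ) F ≡ true → Matches F → std w ≡ oneLine τ
  Matches-valid⇒std≡ F F-col v (L≡n , F∘perm≡) = Increasing⇒std≡ τ w L≡n increasing
    where
    open IsColumnSequence F-col
    increasing : Increasing τ w
    increasing a b a<n b<n a≺b with precedes⁻ a (nth 0 w a) b (nth 0 w b) a≺b
    ... | inj₁ wa<wb = ≰⇒> λ perm-b≤perm-a → <⇒≱ Fa<Fb (monotone (perm b) (perm a) perm-b≤perm-a (perm< a a<n))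
      where
      Fa<Fb : nth 0 F (perm a) < nth 0 F (perm b)
      Fa<Fb = subst₂ _<_ (sym (F∘perm≡ a a<n)) (sym (F∘perm≡ b b<n))
                (s≤s (pack-mono-< a b (subst (a <_) (sym L≡n) a<n) wa<wb))
    ... | inj₂ (a<b , wa≡wb) with <-cmp (perm a) (perm b)
    ...   | tri< pa<pb _ _ = pa<pb
    ...   | tri≈ _ pa≡pb _ = ⊥-elim (<-irrefl (perm-injective a b a<n b<n pa≡pb) a<b)
    ...   | tri> _ _ pb<pa = ⊥-elim (<-asym a<b (subst₂ _<_ (perm⁻¹-perm b b<n) (perm⁻¹-perm a a<n)
            (constant-run-ascending F-col perm⁻¹ (valid-singletonsInv⇒ F length≡ v) (perm b) (perm a) pb<pa (perm< a a<n)
              (trans (F∘perm≡ b b<n) (trans (cong (suc ∘ packed) (sym wa≡wb)) (sym (F∘perm≡ a a<n)))))))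

  canonical : List ℕ
  canonical = applyUpTo (λ i → suc (pack (perm⁻¹ i))) n

  nth-canonical : ∀ i → i < n → nth 0 canonical i ≡ suc (pack (perm⁻¹ i))
  nth-canonical i i<n = nth-applyUpTo 0 n _ i i<n

  Matches-canonical : length w ≡ n → Matches canonical
  Matches-canonical L≡n = L≡n , λ j j<n →
    trans (nth-canonical (perm j) (perm< j j<n)) (cong (suc ∘ pack) (perm⁻¹-perm j j<n))

  Matches⇒≡canonical : ∀ F → length F ≡ n → Matches F → F ≡ canonical
  Matches⇒≡canonical F |F|≡n (_ , F∘perm≡) =
    nth-extensionality 0 F canonical (trans |F|≡n (sym (length-applyUpTo _ n))) λ i i<|F| →
      let i<n = subst (i <_) |F|≡n i<|F| in
      trans (cong (nth 0 F) (sym (perm-perm⁻¹ i i<n)))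
            (trans (F∘perm≡ (perm⁻¹ i) (perm⁻¹< i i<n)) (sym (nth-canonical i i<n)))

  module _ (std≡ : std w ≡ oneLine τ) where

    private
      L≡n : length w ≡ n
      L≡n = proj₁ (std≡⇒Increasing τ w std≡)

      increasing : Increasing τ w
      increasing = proj₂ (std≡⇒Increasing τ w std≡)

      <n⇒<L : ∀ {j} → j < n → j < length w
      <n⇒<L {j} = subst (j <_) (sym L≡n)

      -- A letter strictly between the letters at positions τ⁻¹(i) and τ⁻¹(i+1) would have to sit at a
      -- position p with i < τ(p) < i+1.
      no-letter-between : ∀ i v → suc i < n → nth 0 w (perm⁻¹ i) < v → v < nth 0 w (perm⁻¹ (suc i)) → occurs v ≡ false
      no-letter-between i v i+1<n a<v v<b = ¬letter⇒¬occurs v λ where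
        (j , j<L , refl) → let j<n = subst (j <_) L≡n j<L
                               i<n = <-trans (n<1+n i) i+1<n in
          <-irrefl refl (≤-trans
            (subst (perm j <_) (perm-perm⁻¹ (suc i) i+1<n)
              (increasing j _ j<n (perm⁻¹< (suc i) i+1<n) (precedes-< j _ (perm⁻¹ (suc i)) _ v<b)))
            (subst (_< perm j) (perm-perm⁻¹ i i<n)
              (increasing _ j (perm⁻¹< i i<n) j<n (precedes-< (perm⁻¹ i) _ j _ a<v))))

      pack-first : 0 < n → pack (perm⁻¹ 0) ≡ 0
      pack-first 0<n = packed-constant 0 (nth 0 w (perm⁻¹ 0)) z≤n λ v _ v<first → ¬letter⇒¬occurs v λ where
        (j , j<L , refl) → n≮0 (subst (perm j <_) (perm-perm⁻¹ 0 0<n)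
          (increasing j _ (subst (j <_) L≡n j<L) (perm⁻¹< 0 0<n) (precedes-< j _ (perm⁻¹ 0) _ v<first)))

      canonical-step : ∀ i → suc i < n → Step (nth 0 canonical i) (nth 0 canonical (suc i))
      canonical-step i i+1<n
        rewrite nth-canonical i (<-trans (n<1+n i) i+1<n) | nth-canonical (suc i) i+1<n
        with <-cmp (nth 0 w (perm⁻¹ i)) (nth 0 w (perm⁻¹ (suc i)))
      ... | tri≈ _ a≡b _ = inj₁ (cong (suc ∘ packed) (sym a≡b))
      ... | tri> _ _ b<a = ⊥-elim (<-asym (n<1+n i) (subst₂ _<_ (perm-perm⁻¹ (suc i) i+1<n) (perm-perm⁻¹ i i<n)
              (increasing _ _ (perm⁻¹< (suc i) i+1<n) (perm⁻¹< i i<n) (precedes-< (perm⁻¹ (suc i)) _ (perm⁻¹ i) _ b<a))))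
        where
        i<n : i < n
        i<n = <-trans (n<1+n i) i+1<n
      ... | tri< a<b _ _ = inj₂ (cong suc (trans
              (packed-constant (suc (nth 0 w (perm⁻¹ i))) _ a<b (λ v a<v v<b → no-letter-between i v i+1<n a<v v<b))
              (packed-suc-occurs _ (occurs-letter _ (<n⇒<L (perm⁻¹< i (<-trans (n<1+n i) i+1<n)))))))

    canonical-isColumnSequence : IsColumnSequence n canonical
    canonical-isColumnSequence = record
      { length≡     = length-applyUpTo _ n
      ; starts-at-1 = λ 0<n → trans (nth-canonical 0 0<n) (cong suc (pack-first 0<n))
      ; steps       = canonical-step
      }

    canonical-valid : valid (singletonsInv τ) canonical ≡ true
    canonical-valid = valid-singletonsInv⇐ canonical (length-applyUpTo _ n) ascent
      where
      ascent : ∀ i → suc i < n → nth 0 canonical i ≡ nth 0 canonical (suc i) → perm⁻¹ i < perm⁻¹ (suc i)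
      ascent i i+1<n c≡ with <-cmp (perm⁻¹ i) (perm⁻¹ (suc i))
      ... | tri< a<b _ _ = a<b
      ... | tri≈ _ a≡b _ = ⊥-elim (1+n≢n (sym (perm⁻¹-injective i (suc i) i<n i+1<n a≡b)))
        where
        i<n : i < n
        i<n = <-trans (n<1+n i) i+1<n
      ... | tri> _ _ b<a = ⊥-elim (<-asym (n<1+n i) (subst₂ _<_ (perm-perm⁻¹ (suc i) i+1<n) (perm-perm⁻¹ i i<n)
              (increasing _ _ (perm⁻¹< (suc i) i+1<n) (perm⁻¹< i i<n)
                (precedes-≡ (perm⁻¹ (suc i)) _ (perm⁻¹ i) _ b<a (sym same-letter)))))
        where
        i<n : i < n
        i<n = <-trans (n<1+n i) i+1<n
        same-letter : nth 0 w (perm⁻¹ i) ≡ nth 0 w (perm⁻¹ (suc i))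
        same-letter = pack-injective _ _ (<n⇒<L (perm⁻¹< i i<n)) (<n⇒<L (perm⁻¹< (suc i) i+1<n))
          (suc-injective (trans (sym (nth-canonical i i<n)) (trans c≡ (nth-canonical (suc i) i+1<n))))

    canonical-matches : Matches canonical
    canonical-matches = Matches-canonical L≡n

M-≡ : ∀ Ψ w → ϱ w ≡ Ψ → M Ψ w ≡ 1
M-≡ Ψ w ϱ≡ with ≡-dec (≡-dec _≟_) (ϱ w) Ψ
... | yes _   = refl
... | no  ϱ≢ = ⊥-elim (ϱ≢ ϱ≡)

M-≢ : ∀ Ψ w → ϱ w ≢ Ψ → M Ψ w ≡ 0
M-≢ Ψ w ϱ≢ with ≡-dec (≡-dec _≟_) (ϱ w) Ψ
... | yes ϱ≡ = ⊥-elim (ϱ≢ ϱ≡)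
... | no  _   = refl

sum-map-cong-∈ : ∀ {A : Set} (xs : List A) (f g : A → ℕ) → (∀ x → x ∈ xs → f x ≡ g x) → sum (map f xs) ≡ sum (map g xs)
sum-map-cong-∈ []       f g h = refl
sum-map-cong-∈ (x ∷ xs) f g h = cong₂ _+_ (h x (here refl)) (sum-map-cong-∈ xs f g (λ y y∈ → h y (there y∈)))

count-bfilter : ∀ x (p : List ℕ → Bool) ys → p x ≡ true → count x (bfilter p ys) ≡ count x ys
count-bfilter x p []       px = refl
count-bfilter x p (y ∷ ys) px with p y in py
... | true = cong (𝟙 (y ≡ᵇₗ x) +_) (count-bfilter x p ys px)
... | false with y ≡ᵇₗ x in y≡x
...   | false = count-bfilter x p ys px
...   | true  = contradiction (trans (sym py) (trans (cong p (≡ᵇₗ-true⇒≡ y x y≡x)) px)) λ ()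

P-no-match : ∀ Φ w → (∀ F → F ∈ LDD Φ → ϱ w ≢ col Φ F) → P Φ w ≡ 0
P-no-match Φ w ¬match =
  trans (sum-map-cong-∈ (LDD Φ) _ (λ _ → 0) (λ F F∈ → M-≢ (col Φ F) w (¬match F F∈))) (sum-zero (LDD Φ))
  where
  sum-zero : ∀ {A : Set} (xs : List A) → sum (map (λ _ → 0) xs) ≡ 0
  sum-zero []       = refl
  sum-zero (_ ∷ xs) = sum-zero xs

P-unique-match : ∀ Φ w F₀ → ϱ w ≡ col Φ F₀ → (∀ F → F ∈ LDD Φ → ϱ w ≡ col Φ F → F ≡ F₀) →
                 P Φ w ≡ count F₀ (LDD Φ)
P-unique-match Φ w F₀ match₀ unique = sum-map-cong-∈ (LDD Φ) _ _ indicator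
  where
  indicator : ∀ F → F ∈ LDD Φ → M (col Φ F) w ≡ 𝟙 (F ≡ᵇₗ F₀)
  indicator F F∈ with F ≡ᵇₗ F₀ in F≡F₀
  ... | true  = M-≡ (col Φ F) w (trans match₀ (cong (col Φ) (sym (≡ᵇₗ-true⇒≡ F F₀ F≡F₀))))
  ... | false = M-≢ (col Φ F) w λ match →
    contradiction (trans (sym F≡F₀) (trans (cong (_≡ᵇₗ F₀) (unique F F∈ match)) (≡ᵇₗ-refl F₀))) λ ()

∈-LDD-singletonsInv⁻ : ∀ {n} (τ : Permutation′ n) F → F ∈ LDD (singletonsInv τ) →
                       IsColumnSequence n F × valid (singletonsInv τ) F ≡ true
∈-LDD-singletonsInv⁻ {n} τ F F∈ with ∈-bfilter⁻ (valid (singletonsInv τ)) _ F F∈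
... | F∈colSeqs , v = ∈-colSeqs⁻ n F (subst (λ k → F ∈ colSeqs k) (length-singletonsInv τ) F∈colSeqs) , v

P-singletonsInv-std≢ : ∀ {n} (τ : Permutation′ n) w → std w ≢ oneLine τ → P (singletonsInv τ) w ≡ 0
P-singletonsInv-std≢ τ w std≢ = P-no-match (singletonsInv τ) w λ F F∈ ϱ≡col →
  let F-col , F-valid = ∈-LDD-singletonsInv⁻ τ F F∈ in
  std≢ (Matches-valid⇒std≡ F F-col F-valid (ϱ≡col⇒Matches F F-col ϱ≡col))
  where open Matching τ w

P-singletonsInv-std≡ : ∀ {n} (τ : Permutation′ n) w → std w ≡ oneLine τ → P (singletonsInv τ) w ≡ 1
P-singletonsInv-std≡ {n} τ w std≡ = begin
    P (singletonsInv τ) w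
  ≡⟨ P-unique-match (singletonsInv τ) w canonical (Matches⇒ϱ≡col canonical canonical-col (canonical-matches std≡)) unique ⟩
    count canonical (LDD (singletonsInv τ))
  ≡⟨ count-bfilter canonical (valid (singletonsInv τ)) (colSeqs (length (singletonsInv τ))) (canonical-valid std≡) ⟩
    count canonical (colSeqs (length (singletonsInv τ)))
  ≡⟨ cong (count canonical ∘ colSeqs) (length-singletonsInv τ) ⟩
    count canonical (colSeqs n)
  ≡⟨ count-colSeqs n canonical canonical-col ⟩
    1
  ∎
  where
  open ≡-Reasoning
  open Matching τ w
  canonical-col : IsColumnSequence n canonical
  canonical-col = canonical-isColumnSequence std≡
  unique : ∀ F → F ∈ LDD (singletonsInv τ) → ϱ w ≡ col (singletonsInv τ) F → F ≡ canonical
  unique F F∈ ϱ≡col = let F-col , _ = ∈-LDD-singletonsInv⁻ τ F F∈ in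
    Matches⇒≡canonical F (IsColumnSequence.length≡ F-col) (ϱ≡col⇒Matches F F-col ϱ≡col)

theorem4p8 : (n : ℕ) (τ : Permutation′ n) (w : Word) → Fτ τ w ≡ P (singletonsInv τ) w
theorem4p8 n τ w with ≡-dec _≟_ (std w) (oneLine τ)
... | yes std≡ = sym (P-singletonsInv-std≡ τ w std≡)
... | no  std≢ = sym (P-singletonsInv-std≢ τ w std≢)
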